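{- There exist a constant $c>0$ and cographs $G_1, G_2, \dots$ whose numbers of vertices $n_i$ tend to infinity such that $\mathrm{nd}(G_i) \ge c \log n_i$ for all $i$ (i.e., there are $n$-vertex cographs with neighbor-depth $\Omega(\log n)$).
   Context: A cograph is a graph with no induced path on four vertices. The neighbor-depth $\mathrm{nd}(G)$ is defined recursively: $\mathrm{nd}(G)=0$ iff $V(G)=\emptyset$; if $G$ is disconnected, $\mathrm{nd}(G)$ is the maximum of $\mathrm{nd}$ over its connected components; if $G$ is non-empty and connected, $\mathrm{nd}(G)\le k$ iff there is $v\in V(G)$ with $\mathrm{nd}(G\setminus N[v])\le k-1$ and $\mathrm{nd}(G\setminus\{v\})\le k$ ($N[v]$ the closed neighborhood, $G\setminus X=G[V(G)\setminus X]$). -}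

module Defs where

open import Data.Nat using (ℕ; zero; suc)
open import Data.Fin using (Fin)
open import Data.Bool using (Bool; true; false)
open import Data.Product using (Σ; _×_; ∃-syntax)
open import Relation.Binary.PropositionalEquality using (_≡_; _≢_)
open import Relation.Nullary using (¬_)

record Graph : Set where
  field
    n      : ℕ
    adj    : Fin n → Fin n → Bool
    sym    : ∀ u v → adj u v ≡ adj v u
    irrefl : ∀ v → adj v v ≡ false
open Graph public

-- Vertex subsets (predicates); induced subgraph G[S] is represented by S.
VSet : Graph → Set₁
VSet G = Fin (n G) → Set

module _ (G : Graph) where
  Edge : Fin (n G) → Fin (n G) → Set
  Edge u v = adj G u v ≡ true

  NonEdge : Fin (n G) → Fin (n G) → Set
  NonEdge u v = adj G u v ≡ false

  -- Cograph: no induced path a-b-c-d on four vertices.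
  -- (Distinctness of a,b,c,d is forced by the edge/non-edge pattern.)
  IsCograph : Set
  IsCograph = ¬ (∃[ a ] ∃[ b ] ∃[ c ] ∃[ d ]
                   (Edge a b × Edge b c × Edge c d ×
                    NonEdge a c × NonEdge b d × NonEdge a d))

  data Reach (S : VSet G) (u : Fin (n G)) : Fin (n G) → Set where
    here : S u → Reach S u u
    step : ∀ {w x} → Reach S u w → S x → Edge w x → Reach S u x

  Empty : VSet G → Set
  Empty S = ∀ v → ¬ S v

  Connected : VSet G → Set
  Connected S = ∀ u w → S u → S w → Reach S u w

  Comp : VSet G → Fin (n G) → VSet G
  Comp S v u = S u × Reach S v u

  Del : VSet G → Fin (n G) → VSet G
  Del S v u = S u × u ≢ v

  DelN : VSet G → Fin (n G) → VSet G
  DelN S v u = S u × u ≢ v × NonEdge v u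

  -- NdLe S k  means  nd(G[S]) ≤ k, following the recursive definition.
  data NdLe : VSet G → ℕ → Set₁ where
    empty : ∀ {S k} → Empty S → NdLe S k
    disconnected : ∀ {S k} → ¬ Connected S →
                   (∀ v → S v → NdLe (Comp S v) k) → NdLe S k
    connected : ∀ {S k} → ¬ Empty S → Connected S →
                ∀ v → S v → NdLe (DelN S v) k → NdLe (Del S v) (suc k) →
                NdLe S (suc k)

  AllV : VSet G
  AllV _ = Data.Unit.⊤
    where import Data.Unit

  ndLe : ℕ → Set₁
  ndLe k = NdLe AllV k

-- G₀ = K₁ and Gₘ₊₁ = (Gₘ + Gₘ) ⋈ (Gₘ + Gₘ) are cographs on 4ᵐ vertices, since
-- cographs are closed under disjoint union and join. Suppose an induced copy of Gₘ
-- sits inside G[S]. It is connected, so it lies in one component; deleting a vertex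
-- outside the copy keeps it; and if the deleted vertex v is in the copy, then the
-- other copy of Gₘ₋₁ in v's half of the join lies in S ∖ N[v]. By induction
-- nd(G[S]) > m, so nd(Gₘ) > m = log₄ n.
module Submission where

open import Defs
open import Data.Nat using (ℕ; _≤_; _*_; _^_; zero; suc; _+_; _<_; s≤s; z≤n)
open import Data.Product using (Σ; _×_; ∃-syntax; _,_)
open import Data.Nat.Properties
  using (≤-trans; <⇒≤; m≤m+n; +-mono-≤; ^-monoʳ-≤; ^-*-assoc; module ≤-Reasoning)
open import Data.Nat.Tactic.RingSolver using (solve-∀)
open import Data.Fin as Fin using (Fin; _↑ˡ_; _↑ʳ_; splitAt; join; _≟_)
open import Data.Fin.Properties
  using ( any?; ↑ˡ-injective; ↑ʳ-injective
        ; splitAt-↑ˡ; splitAt-↑ʳ; splitAt⁻¹-↑ˡ; splitAt⁻¹-↑ʳ; splitAt-join)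
open import Data.Bool using (Bool; true; false; not)
open import Data.Sum using (_⊎_; inj₁; inj₂)
open import Data.Unit using (tt)
open import Data.Empty using (⊥-elim)
open import Relation.Nullary using (¬_; yes; no)
open import Relation.Binary.PropositionalEquality
  using (_≡_; _≢_; refl; trans; cong; cong₂; subst)
  renaming (sym to ≡-sym)

P4Free : {V : Set} → (V → V → Bool) → Set
P4Free E = ¬ (∃[ a ] ∃[ b ] ∃[ c ] ∃[ d ]
              (E a b ≡ true × E b c ≡ true × E c d ≡ true ×
               E a c ≡ false × E b d ≡ false × E a d ≡ false))

P4Free-pullback : {V W : Set} {E : W → W → Bool} (f : V → W) →
                  P4Free E → P4Free (λ x y → E (f x) (f y))
P4Free-pullback f free (a , b , c , d , path) = free (f a , f b , f c , f d , path)

module _ {A B : Set} where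

  sumAdj : Bool → (A → A → Bool) → (B → B → Bool) → A ⊎ B → A ⊎ B → Bool
  sumAdj cross E F (inj₁ x) (inj₁ y) = E x y
  sumAdj cross E F (inj₂ x) (inj₂ y) = F x y
  sumAdj cross E F _        _        = cross

  sumAdj-sym : ∀ {cross E F} → (∀ x y → E x y ≡ E y x) → (∀ x y → F x y ≡ F y x) →
               ∀ u v → sumAdj cross E F u v ≡ sumAdj cross E F v u
  sumAdj-sym E-sym F-sym (inj₁ x) (inj₁ y) = E-sym x y
  sumAdj-sym E-sym F-sym (inj₁ x) (inj₂ y) = refl
  sumAdj-sym E-sym F-sym (inj₂ x) (inj₁ y) = refl
  sumAdj-sym E-sym F-sym (inj₂ x) (inj₂ y) = F-sym x y

  sumAdj-irrefl : ∀ {cross E F} → (∀ x → E x x ≡ false) → (∀ x → F x x ≡ false) →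
                  ∀ u → sumAdj cross E F u u ≡ false
  sumAdj-irrefl E-irr F-irr (inj₁ x) = E-irr x
  sumAdj-irrefl E-irr F-irr (inj₂ x) = F-irr x

  data SameSide : A ⊎ B → A ⊎ B → Set where
    left  : ∀ {x y} → SameSide (inj₁ x) (inj₁ y)
    right : ∀ {x y} → SameSide (inj₂ x) (inj₂ y)

  -- With cross = false the edges, with cross = true the non-edges stay within a side.
  sameSide : ∀ cross {E F} u v → sumAdj cross E F u v ≡ not cross → SameSide u v
  sameSide _     (inj₁ x) (inj₁ y) _  = left
  sameSide _     (inj₂ x) (inj₂ y) _  = right
  sameSide false (inj₁ x) (inj₂ y) ()
  sameSide false (inj₂ x) (inj₁ y) ()
  sameSide true  (inj₁ x) (inj₂ y) ()
  sameSide true  (inj₂ x) (inj₁ y) ()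

  sumAdj-P4Free : ∀ cross {E F} → P4Free E → P4Free F → P4Free (sumAdj cross E F)
  sumAdj-P4Free false E-free F-free (a , b , c , d , ab , bc , cd , ac , bd , ad)
    with sameSide false a b ab | sameSide false b c bc | sameSide false c d cd
  ... | left  | left  | left  = E-free (_ , _ , _ , _ , ab , bc , cd , ac , bd , ad)
  ... | right | right | right = F-free (_ , _ , _ , _ , ab , bc , cd , ac , bd , ad)
  sumAdj-P4Free true E-free F-free (a , b , c , d , ab , bc , cd , ac , bd , ad)
    with sameSide true a c ac | sameSide true b d bd | sameSide true a d ad
  ... | left  | left  | left  = E-free (_ , _ , _ , _ , ab , bc , cd , ac , bd , ad)
  ... | right | right | right = F-free (_ , _ , _ , _ , ab , bc , cd , ac , bd , ad)

data Side (m n : ℕ) : Fin (m + n) → Set where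
  onLeft  : (x : Fin m) → Side m n (x ↑ˡ n)
  onRight : (y : Fin n) → Side m n (m ↑ʳ y)

side : ∀ m {n} (i : Fin (m + n)) → Side m n i
side m i with splitAt m i in eq
... | inj₁ x = subst (Side m _) (splitAt⁻¹-↑ˡ eq) (onLeft x)
... | inj₂ y = subst (Side m _) (splitAt⁻¹-↑ʳ eq) (onRight y)

↑ˡ≢↑ʳ : ∀ {m n} (x : Fin m) (y : Fin n) → x ↑ˡ n ≢ m ↑ʳ y
↑ˡ≢↑ʳ {m} {n} x y eq
  with () ← trans (≡-sym (splitAt-↑ˡ m x n)) (trans (cong (splitAt m) eq) (splitAt-↑ʳ m n y))

sumGraph : Bool → Graph → Graph → Graph
sumGraph cross G H = record
  { n      = n G + n H
  ; adj    = λ u v → sumAdj cross (adj G) (adj H) (splitAt (n G) u) (splitAt (n G) v)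
  ; sym    = λ u v → sumAdj-sym (sym G) (sym H) (splitAt (n G) u) (splitAt (n G) v)
  ; irrefl = λ u → sumAdj-irrefl (irrefl G) (irrefl H) (splitAt (n G) u)
  }

_⊎ᴳ_ : Graph → Graph → Graph
_⊎ᴳ_ = sumGraph false

_⋈_ : Graph → Graph → Graph
_⋈_ = sumGraph true

record Embedding (H G : Graph) (S : VSet G) : Set where
  field
    map       : Fin (n H) → Fin (n G)
    adj-map   : ∀ x y → adj G (map x) (map y) ≡ adj H x y
    injective : ∀ {x y} → map x ≡ map y → x ≡ y
    into      : ∀ x → S (map x)
open Embedding

idᴱ : ∀ G → Embedding G G (AllV G)
idᴱ G = record
  { map = λ x → x ; adj-map = λ _ _ → refl ; injective = λ eq → eq ; into = λ _ → tt }

module _ {H G : Graph} {S : VSet G} (e : Embedding H G S) where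

  restrict : {T : VSet G} → (∀ x → T (map e x)) → Embedding H G T
  restrict into-T = record
    { map = map e ; adj-map = adj-map e ; injective = injective e ; into = into-T }

  map-reach : ∀ {x y} → Reach H (AllV H) x y → Reach G S (map e x) (map e y)
  map-reach (here _)        = here (into e _)
  map-reach (step r _ edge) = step (map-reach r) (into e _) (trans (adj-map e _ _) edge)

  intoComponent : Connected H (AllV H) → ∀ r → Embedding H G (Comp G S (map e r))
  intoComponent H-conn r = restrict (λ x → into e x , map-reach (H-conn r x tt tt))

  compose-avoiding : ∀ {K x} → Embedding K H (DelN H (AllV H) x) → Embedding K G (DelN G S (map e x))
  compose-avoiding {x = x} f = record
    { map       = λ y → map e (map f y)
    ; adj-map   = λ y z → trans (adj-map e _ _) (adj-map f y z)
    ; injective = λ eq → injective f (injective e eq)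
    ; into      = λ y → let (_ , fy≢x , x≁fy) = into f y in
                        into e _ , (λ eq → fy≢x (injective e eq)) , trans (adj-map e x _) x≁fy
    }

FarCopies : Graph → Graph → Set
FarCopies A G = ∀ x → Embedding A G (DelN G (AllV G) x)

sumGraph-adj : ∀ cross G H u v →
               adj (sumGraph cross G H) (join (n G) (n H) u) (join (n G) (n H) v)
                 ≡ sumAdj cross (adj G) (adj H) u v
sumGraph-adj cross G H u v =
  cong₂ (sumAdj cross (adj G) (adj H)) (splitAt-join (n G) (n H) u) (splitAt-join (n G) (n H) v)

sumGraph-cograph : ∀ cross G H → IsCograph G → IsCograph H → IsCograph (sumGraph cross G H)
sumGraph-cograph cross G H G-cog H-cog =
  P4Free-pullback (splitAt (n G)) (sumAdj-P4Free cross G-cog H-cog)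

module _ {cross : Bool} {G H : Graph} where

  inlᴱ : Embedding G (sumGraph cross G H) (AllV (sumGraph cross G H))
  inlᴱ = record
    { map = _↑ˡ n H ; adj-map = λ x y → sumGraph-adj cross G H (inj₁ x) (inj₁ y)
    ; injective = ↑ˡ-injective (n H) _ _ ; into = λ _ → tt }

  inrᴱ : Embedding H (sumGraph cross G H) (AllV (sumGraph cross G H))
  inrᴱ = record
    { map = n G ↑ʳ_ ; adj-map = λ x y → sumGraph-adj cross G H (inj₂ x) (inj₂ y)
    ; injective = ↑ʳ-injective (n G) _ _ ; into = λ _ → tt }

  sumGraph-farCopies : ∀ {A} → FarCopies A G → FarCopies A H → FarCopies A (sumGraph cross G H)
  sumGraph-farCopies G-far H-far x with side (n G) x
  ... | onLeft  y = compose-avoiding inlᴱ (G-far y)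
  ... | onRight y = compose-avoiding inrᴱ (H-far y)

module _ {G H : Graph} where

  right-copy-avoids : ∀ x → Embedding H (G ⊎ᴳ H) (DelN (G ⊎ᴳ H) (AllV (G ⊎ᴳ H)) (x ↑ˡ n H))
  right-copy-avoids x = restrict inrᴱ λ y →
    tt , (λ eq → ↑ˡ≢↑ʳ x y (≡-sym eq)) , sumGraph-adj false G H (inj₁ x) (inj₂ y)

  left-copy-avoids : ∀ y → Embedding G (G ⊎ᴳ H) (DelN (G ⊎ᴳ H) (AllV (G ⊎ᴳ H)) (n G ↑ʳ y))
  left-copy-avoids y = restrict inlᴱ λ x →
    tt , ↑ˡ≢↑ʳ x y , sumGraph-adj false G H (inj₂ y) (inj₁ x)

  ⋈-connected : Fin (n G) → Fin (n H) → Connected (G ⋈ H) (AllV (G ⋈ H))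
  ⋈-connected g h u w _ _ with side (n G) {n H} u | side (n G) {n H} w
  ... | onLeft  x | onRight y = step (here tt) tt (sumGraph-adj true G H (inj₁ x) (inj₂ y))
  ... | onRight y | onLeft  x = step (here tt) tt (sumGraph-adj true G H (inj₂ y) (inj₁ x))
  ... | onLeft  x | onLeft  x′ =
    step (step (here tt) tt (sumGraph-adj true G H (inj₁ x) (inj₂ h))) tt
         (sumGraph-adj true G H (inj₂ h) (inj₁ x′))
  ... | onRight y | onRight y′ =
    step (step (here tt) tt (sumGraph-adj true G H (inj₂ y) (inj₁ g))) tt
         (sumGraph-adj true G H (inj₁ g) (inj₂ y′))

⊎ᴳ-farCopies : ∀ {A} → FarCopies A (A ⊎ᴳ A)
⊎ᴳ-farCopies {A} x with side (n A) x
... | onLeft  y = right-copy-avoids y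
... | onRight y = left-copy-avoids y

K₁ : Graph
K₁ = record { n = 1 ; adj = λ _ _ → false ; sym = λ _ _ → refl ; irrefl = λ _ → refl }

tower : ℕ → Graph
tower zero    = K₁
tower (suc m) = (tower m ⊎ᴳ tower m) ⋈ (tower m ⊎ᴳ tower m)

tower-root : ∀ m → Fin (n (tower m))
tower-root zero    = Fin.zero
tower-root (suc m) = (tower-root m ↑ˡ n (tower m)) ↑ˡ n (tower m ⊎ᴳ tower m)

tower-cograph : ∀ m → IsCograph (tower m)
tower-cograph zero    (_ , _ , _ , _ , () , _)
tower-cograph (suc m) = sumGraph-cograph true G+G G+G G+G-cograph G+G-cograph
  where
  G+G : Graph
  G+G = tower m ⊎ᴳ tower m

  G+G-cograph : IsCograph G+G
  G+G-cograph = sumGraph-cograph false (tower m) (tower m) (tower-cograph m) (tower-cograph m)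

tower-connected : ∀ m → Connected (tower m) (AllV (tower m))
tower-connected zero    Fin.zero Fin.zero _ _ = here tt
tower-connected (suc m) = ⋈-connected r r
  where
  r : Fin (n (tower m ⊎ᴳ tower m))
  r = tower-root m ↑ˡ n (tower m)

tower-farCopies : ∀ m → FarCopies (tower m) (tower (suc m))
tower-farCopies m = sumGraph-farCopies ⊎ᴳ-farCopies ⊎ᴳ-farCopies

NdLe-tower : ∀ {G S k} → NdLe G S k → ∀ m → Embedding (tower m) G S → m < k
NdLe-tower (empty S-empty) m e = ⊥-elim (S-empty _ (into e (tower-root m)))
NdLe-tower (disconnected _ byComponent) m e =
  NdLe-tower (byComponent _ (into e (tower-root m))) m
             (intoComponent e (tower-connected m) (tower-root m))
NdLe-tower (connected _ _ _ _ _ _) zero e = s≤s z≤n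
NdLe-tower (connected _ _ v _ nd-DelN nd-Del) (suc m) e with any? (λ x → map e x ≟ v)
... | no  v∉e      =
  NdLe-tower nd-Del (suc m) (restrict e (λ x → into e x , λ ex≡v → v∉e (x , ex≡v)))
... | yes (x , refl) = s≤s (NdLe-tower nd-DelN m (compose-avoiding e (tower-farCopies m x)))

tower-size : ∀ m → n (tower m) ≡ 4 ^ m
tower-size zero    = refl
tower-size (suc m) = trans (quadruple (n (tower m))) (cong (4 *_) (tower-size m))
  where
  quadruple : ∀ x → x + x + (x + x) ≡ 4 * x
  quadruple = solve-∀

m<n[tower[m]] : ∀ m → m < n (tower m)
m<n[tower[m]] zero    = s≤s z≤n
m<n[tower[m]] (suc m) = ≤-trans (+-mono-≤ (≤-trans (s≤s z≤n) m<N) m<N) (m≤m+n _ _)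
  where
  m<N : m < n (tower m)
  m<N = m<n[tower[m]] m

proposition6 : ∃[ d ] (1 ≤ d × Σ (ℕ → Graph) λ G →
                 (∀ i → IsCograph (G i)) ×
                 (∀ m → ∃[ i₀ ] ∀ i → i₀ ≤ i → m ≤ n (G i)) ×
                 (∀ i k → ndLe (G i) k → n (G i) ≤ 2 ^ (d * k)))
proposition6 = 2 , s≤s z≤n , tower , tower-cograph , unbounded , size-bound
  where
  unbounded : ∀ m → ∃[ i₀ ] ∀ i → i₀ ≤ i → m ≤ n (tower i)
  unbounded m = m , λ i m≤i → ≤-trans m≤i (<⇒≤ (m<n[tower[m]] i))

  size-bound : ∀ i k → ndLe (tower i) k → n (tower i) ≤ 2 ^ (2 * k)
  size-bound i k nd = begin
    n (tower i) ≡⟨ tower-size i ⟩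
    4 ^ i       ≤⟨ ^-monoʳ-≤ 4 (<⇒≤ (NdLe-tower nd i (idᴱ (tower i)))) ⟩
    4 ^ k       ≡⟨ ^-*-assoc 2 2 k ⟩
    2 ^ (2 * k) ∎
    where open ≤-Reasoning
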